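{- Let $G$ be a finite group acting on $[m]=\{0,1,\dots,m-1\}$, let $s$ be an $m$-switch table for $G$, let $\sigma_i=1+\#\{j>i: s(i,j)\ne\mathrm{id}\}$ for $i\in[m]$, and let $\sigma=\sigma_0\sigma_1\cdots\sigma_{m-1}$. Let $G_{[m]}=\{g\in G: g(j)=j\text{ for all } j\in[m]\}$ be the kernel of the action. Then $\sigma\le m!$, and equality holds if and only if the quotient $G/G_{[m]}$ (viewed as a subgroup of $\mathrm{Sym}(m)$ via the action) is the whole symmetric group $\mathrm{Sym}(m)$. Moreover, if the action of $G$ on $[m]$ is faithful, then $\sigma$ equals the order of $G$.
   Context: An $m$-switch table for $G$ is a function $s:[m]\times[m]\to G$ such that for each $(i,j)$: if there exists $g\in G$ with $g(k)=k$ for all $k<i$ and $g(j)=i$, then $s(i,j)$ is such an element $g$; otherwise $s(i,j)=\mathrm{id}$. The paper's convention is that $s(i,j)\ne\mathrm{id}$ only when $j>i$ (in particular $s(i,i)=\mathrm{id}$). -}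

module Defs where

open import Level using (Level; _⊔_)
open import Algebra.Bundles using (Group)
open import Data.Nat using (ℕ; suc; _<_)
open import Data.Fin using (Fin; toℕ)
open import Data.List using (List; length; filter; map; allFin)
open import Data.Nat.ListAction using (product)
open import Data.List.Relation.Unary.Any using (Any)
open import Data.List.Relation.Unary.AllPairs using (AllPairs)
open import Data.Product using (_×_; ∃)
open import Relation.Binary.Definitions using (Decidable)
open import Relation.Binary.PropositionalEquality using (_≡_)
open import Relation.Nullary using (¬_; Dec; yes; no)
open import Data.Fin.Permutation using (Permutation′; _⟨$⟩ʳ_)

record FiniteGroup (c ℓ : Level) : Set (Level.suc (c ⊔ ℓ)) where
  field
    group    : Group c ℓ
  open Group group public
  field
    _≟_      : Decidable _≈_
    elems    : List Carrier
    complete : ∀ g → Any (g ≈_) elems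
    distinct : AllPairs (λ a b → ¬ (a ≈ b)) elems

  order : ℕ
  order = length elems

record Action {c ℓ} (G : FiniteGroup c ℓ) (m : ℕ) : Set (c ⊔ ℓ) where
  open FiniteGroup G
  field
    act      : Carrier → Fin m → Fin m
    act-cong : ∀ {g h} → g ≈ h → ∀ x → act g x ≡ act h x
    act-id   : ∀ x → act ε x ≡ x
    act-∙    : ∀ g h x → act (g ∙ h) x ≡ act g (act h x)

module _ {c ℓ} {G : FiniteGroup c ℓ} {m : ℕ} (A : Action G m) where
  open FiniteGroup G
  open Action A

  Switches : Fin m → Fin m → Carrier → Set
  Switches i j g = (∀ (k : Fin m) → toℕ k < toℕ i → act g k ≡ k) × act g j ≡ i

  record SwitchTable : Set (c ⊔ ℓ) where
    field
      s        : Fin m → Fin m → Carrier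
      s-switch : ∀ i j → ∃ (Switches i j) → Switches i j (s i j)
      s-id     : ∀ i j → ¬ ∃ (Switches i j) → s i j ≈ ε
      s-diag   : ∀ i → s i i ≈ ε

    σᵢ : Fin m → ℕ
    σᵢ i = suc (length (filter (λ j → nontriv j) (allFin m)))
      where
      nontriv : (j : Fin m) → Dec (toℕ i < toℕ j × ¬ (s i j ≈ ε))
      nontriv j with toℕ i Data.Nat.<? toℕ j | s i j ≟ ε
      ... | yes p | no q  = yes (p Data.Product., q)
      ... | no p  | _     = no (λ r → p (Data.Product.proj₁ r))
      ... | yes _ | yes q = no (λ r → Data.Product.proj₂ r q)

    σ : ℕ
    σ = product (map σᵢ (allFin m))

  -- the induced map G → Sym(m) is onto, i.e. G/G_[m] = Sym(m)
  InducesFullSym : Set c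
  InducesFullSym = ∀ (π : Permutation′ m) → ∃ λ g → ∀ x → act g x ≡ π ⟨$⟩ʳ x

  Faithful : Set (c ⊔ ℓ)
  Faithful = ∀ g → (∀ x → act g x ≡ x) → g ≈ ε

-- Sift through the stabiliser chain G = G_(0) ≥ G_(1) ≥ … ≥ G_(m) = G_[m], where G_(i) fixes 0, …, i-1.
-- The orbit of i under G_(i) consists of i and the j > i with s(i,j) ≠ id, so it has σ_i elements, and
-- g ↦ (g i, s(i, g i) g) identifies G_(i) with orbit × G_(i+1); hence |G| = σ |G_[m]|.
-- The orbit lies in {i, …, m-1}, so σ_i ≤ m - i and σ ≤ m!, with equality iff every switch s(i,j), i < j,
-- exists. Switches for all i < j let one sift any permutation down to the identity, so G induces Sym(m);
-- conversely an element inducing the transposition (i j) is a switch for (i,j).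
module Submission where

open import Defs
open import Data.Empty using (⊥-elim)
open import Data.Fin using (Fin; toℕ; fromℕ<; zero; suc; _≟_)
open import Data.Fin.Properties using (toℕ-injective; toℕ<n; toℕ-fromℕ<)
import Data.Fin.Properties as Fin
open import Data.Fin.Permutation using (Permutation′; _⟨$⟩ʳ_; _⟨$⟩ˡ_; transpose)
import Data.Fin.Permutation as Permutation
import Data.Fin.Permutation.Components as PermutationComponents
open import Data.List using (List; []; _∷_; length; filter; map; allFin; tabulate; applyUpTo; cartesianProduct; _++_)
open import Data.List.Properties
  using (length-++; length-map; length-removeAt′; length-applyUpTo; filter-≐; filter-all; map-tabulate; tabulate-cong)
open import Data.List.Relation.Unary.Any as Any using (here; there; index)
open import Data.List.Relation.Unary.All as All using (All; []; _∷_)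
import Data.List.Relation.Unary.All.Properties as All
open import Data.List.Relation.Unary.AllPairs using ([]; _∷_)
import Data.List.Relation.Unary.Unique.Setoid.Properties as Unique
open import Data.List.Relation.Unary.Unique.Propositional using () renaming (Unique to Uniqueₚ)
import Data.List.Relation.Unary.Unique.Propositional.Properties as Uniqueₚ
import Data.List.Membership.Setoid as Membership
import Data.List.Membership.Setoid.Properties as Membershipₛ
open import Data.List.Membership.Propositional using (_∈_; _∉_)
import Data.List.Membership.Propositional.Properties as Membershipₚ
open import Data.Nat
  using (ℕ; zero; suc; _+_; _*_; _∸_; _≤_; _<_; _!; z≤n; s≤s; _<?_; NonZero; >-nonZero) renaming (_≟_ to _≟ℕ_)
open import Data.Nat.ListAction using (product)
open import Data.Nat.ListAction.Properties using (product≢0)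
open import Data.Nat.Properties hiding (_≟_)
open import Data.Product using (_×_; ∃; _,_; proj₁; proj₂)
open import Data.Product.Relation.Binary.Pointwise.NonDependent using (_×ₛ_)
open import Data.Sum using (inj₁; inj₂)
open import Function using (_∘_; id)
open import Function.Bundles using (_⇔_; mk⇔)
open import Relation.Binary.Bundles using (Setoid)
open import Relation.Binary.PropositionalEquality as ≡ using (_≡_; _≢_; refl; sym; trans; cong; cong₂; subst)
open import Relation.Nullary using (¬_; Dec; yes; no)
open import Relation.Nullary.Decidable using (_×-dec_; _→-dec_; ¬?; dec-true; dec-false)
open import Relation.Unary using (Decidable)

-- Counting in setoids

module _ {a ℓ} (S : Setoid a ℓ) where
  open Setoid S using (_≉_) renaming (trans to ≈-trans; sym to ≈-sym)
  open Membership S using () renaming (_∈_ to _∈ₛ_)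
  open import Data.List.Relation.Unary.Unique.Setoid S using (Unique)

  ∈-─⁺ : ∀ {x y ys} (x∈ys : x ∈ₛ ys) → y ∈ₛ ys → x ≉ y → y ∈ₛ (ys Any.─ x∈ys)
  ∈-─⁺ (here x≈z)   (here y≈z)   x≉y = ⊥-elim (x≉y (≈-trans x≈z (≈-sym y≈z)))
  ∈-─⁺ (here _)     (there y∈ys) _   = y∈ys
  ∈-─⁺ (there _)    (here y≈z)   _   = here y≈z
  ∈-─⁺ (there x∈ys) (there y∈ys) x≉y = there (∈-─⁺ x∈ys y∈ys x≉y)

  unique⇒length≤ : ∀ {xs ys} → Unique xs → All (_∈ₛ ys) xs → length xs ≤ length ys
  unique⇒length≤ [] [] = z≤n
  unique⇒length≤ {x ∷ xs} {ys} (x≉xs ∷ xs!) (x∈ys ∷ xs⊆ys) = begin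
    suc (length xs)              ≤⟨ s≤s (unique⇒length≤ xs! xs⊆ys─x) ⟩
    suc (length (ys Any.─ x∈ys)) ≡⟨ length-removeAt′ ys (index x∈ys) ⟨
    length ys                    ∎
    where
    open ≤-Reasoning
    xs⊆ys─x : All (_∈ₛ (ys Any.─ x∈ys)) xs
    xs⊆ys─x = All.zipWith (λ (y∈ys , x≉y) → ∈-─⁺ x∈ys y∈ys x≉y) (xs⊆ys , x≉xs)

module _ {a b ℓ₁ ℓ₂} (S : Setoid a ℓ₁) (T : Setoid b ℓ₂) where
  open Setoid S using () renaming (Carrier to A; _≈_ to _≈₁_)
  open Setoid T using () renaming (Carrier to B; _≈_ to _≈₂_)
  open Membership T using () renaming (_∈_ to _∈₂_)
  open import Data.List.Relation.Unary.Unique.Setoid using (Unique)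

  length-≡-by-bijection : ∀ {f : A → B} → (∀ {x y} → f x ≈₂ f y → x ≈₁ y) →
                          ∀ {xs ys} → Unique S xs → Unique T ys →
                          All (λ x → f x ∈₂ ys) xs → All (_∈₂ map f xs) ys →
                          length xs ≡ length ys
  length-≡-by-bijection {f} f-inj {xs} {ys} xs! ys! into onto = ≤-antisym
    (subst (_≤ length ys) (length-map f xs)
      (unique⇒length≤ T (Unique.map⁺ S T f-inj xs!) (All.map⁺ into)))
    (subst (length ys ≤_) (length-map f xs) (unique⇒length≤ T ys! onto))

length-cartesianProduct : ∀ {a b} {A : Set a} {B : Set b} (xs : List A) (ys : List B) →
                          length (cartesianProduct xs ys) ≡ length xs * length ys
length-cartesianProduct []       ys = refl
length-cartesianProduct (x ∷ xs) ys = begin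
  length (map (x ,_) ys ++ cartesianProduct xs ys)         ≡⟨ length-++ (map (x ,_) ys) ⟩
  length (map (x ,_) ys) + length (cartesianProduct xs ys) ≡⟨ cong₂ _+_ (length-map (x ,_) ys)
                                                                         (length-cartesianProduct xs ys) ⟩
  length ys + length xs * length ys                        ∎
  where open ≡.≡-Reasoning

-- Intervals and products of naturals

interval : ℕ → ℕ → List ℕ
interval a b = applyUpTo (a +_) (b ∸ a)

length-interval : ∀ a b → length (interval a b) ≡ b ∸ a
length-interval a b = length-applyUpTo (a +_) (b ∸ a)

interval-unique : ∀ a b → Uniqueₚ (interval a b)
interval-unique a b = Uniqueₚ.applyUpTo⁺₁ (a +_) (b ∸ a) (λ d<e _ → <⇒≢ (+-monoʳ-< a d<e))

∈-interval⁺ : ∀ {a b k} → a ≤ k → k < b → k ∈ interval a b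
∈-interval⁺ {a} {b} {k} a≤k k<b = subst (_∈ interval a b) (m+[n∸m]≡n a≤k)
  (Membershipₚ.∈-applyUpTo⁺ (a +_) (∸-monoˡ-< k<b a≤k))

∈-interval⁻ : ∀ {a b k} → a ≤ b → k ∈ interval a b → a ≤ k × k < b
∈-interval⁻ {a} {b} a≤b k∈ with d , d<b∸a , refl ← Membershipₚ.∈-applyUpTo⁻ (a +_) k∈ =
  m≤m+n a d , (begin-strict
    a + d       <⟨ +-monoʳ-< a d<b∸a ⟩
    a + (b ∸ a) ≡⟨ m+[n∸m]≡n a≤b ⟩
    b           ∎)
  where open ≤-Reasoning

telescope : ∀ {n} (a : ℕ → ℕ) (f : Fin n → ℕ) → (∀ i → a (toℕ i) ≡ f i * a (suc (toℕ i))) →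
            a 0 ≡ product (tabulate f) * a n
telescope {zero}  a f step = sym (*-identityˡ (a 0))
telescope {suc n} a f step = begin
  a 0                                                 ≡⟨ step zero ⟩
  f zero * a 1                                        ≡⟨ cong (f zero *_) (telescope (a ∘ suc) (f ∘ suc) step′) ⟩
  f zero * (product (tabulate (f ∘ suc)) * a (suc n)) ≡⟨ *-assoc (f zero) _ _ ⟨
  product (tabulate f) * a (suc n)                    ∎
  where
  open ≡.≡-Reasoning
  step′ : ∀ i → a (suc (toℕ i)) ≡ f (suc i) * a (suc (suc (toℕ i)))
  step′ = step ∘ suc

product-tabulate-∸ : ∀ n → product (tabulate (λ (i : Fin n) → n ∸ toℕ i)) ≡ n !
product-tabulate-∸ zero    = refl
product-tabulate-∸ (suc n) = cong (suc n *_) (product-tabulate-∸ n)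

product-tabulate-mono-≤ : ∀ {n} {f g : Fin n → ℕ} → (∀ i → f i ≤ g i) →
                          product (tabulate f) ≤ product (tabulate g)
product-tabulate-mono-≤ {zero}  _   = ≤-refl
product-tabulate-mono-≤ {suc n} f≤g = *-mono-≤ (f≤g zero) (product-tabulate-mono-≤ (f≤g ∘ suc))

product-tabulate-mono-< : ∀ {n} {f g : Fin n → ℕ} → (∀ i → f i ≤ g i) → (∀ i → NonZero (g i)) →
                          ∀ i → f i < g i → product (tabulate f) < product (tabulate g)
product-tabulate-mono-< {suc n} {f} {g} f≤g g≢0 zero f₀<g₀ = begin-strict
  f zero * P ≤⟨ *-monoʳ-≤ (f zero) (product-tabulate-mono-≤ (f≤g ∘ suc)) ⟩
  f zero * Q <⟨ *-monoˡ-< Q {{product≢0 (All.tabulate⁺ (g≢0 ∘ suc))}} f₀<g₀ ⟩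
  g zero * Q ∎
  where
  open ≤-Reasoning
  P = product (tabulate (f ∘ suc))
  Q = product (tabulate (g ∘ suc))
product-tabulate-mono-< {suc n} {f} {g} f≤g g≢0 (suc i) fᵢ<gᵢ = begin-strict
  f zero * P ≤⟨ *-monoˡ-≤ P (f≤g zero) ⟩
  g zero * P <⟨ *-monoʳ-< (g zero) {{g≢0 zero}} (product-tabulate-mono-< (f≤g ∘ suc) (g≢0 ∘ suc) i fᵢ<gᵢ) ⟩
  g zero * Q ∎
  where
  open ≤-Reasoning
  P = product (tabulate (f ∘ suc))
  Q = product (tabulate (g ∘ suc))

product-tabulate-≡⇒≗ : ∀ {n} {f g : Fin n → ℕ} → (∀ i → f i ≤ g i) → (∀ i → NonZero (g i)) →
                       product (tabulate f) ≡ product (tabulate g) → ∀ i → f i ≡ g i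
product-tabulate-≡⇒≗ f≤g g≢0 eq i =
  ≤-antisym (f≤g i) (≮⇒≥ (λ fi<gi → <⇒≢ (product-tabulate-mono-< f≤g g≢0 i fi<gi) eq))

transpose-matchˡ : ∀ {n} (i j : Fin n) → PermutationComponents.transpose i j i ≡ j
transpose-matchˡ i j rewrite dec-true (i ≟ i) refl = refl

transpose-other : ∀ {n} {i j k : Fin n} → k ≢ i → k ≢ j → PermutationComponents.transpose i j k ≡ k
transpose-other {i = i} {j} {k} k≢i k≢j rewrite dec-false (k ≟ i) k≢i | dec-false (k ≟ j) k≢j = refl

-- Group actions and switch tables

module _ {c ℓ} {G : FiniteGroup c ℓ} {m : ℕ} (A : Action G m) where
  open FiniteGroup G
    renaming (refl to ≈-refl; sym to ≈-sym; trans to ≈-trans; reflexive to ≈-reflexive; _≟_ to _≈?_)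
  open Action A
  open import Algebra.Properties.Group group using (∙-cancelˡ; \\-leftDividesˡ)

  act-inverseˡ : ∀ g x → act (g ⁻¹) (act g x) ≡ x
  act-inverseˡ g x = begin
    act (g ⁻¹) (act g x) ≡⟨ act-∙ (g ⁻¹) g x ⟨
    act (g ⁻¹ ∙ g) x     ≡⟨ act-cong (inverseˡ g) x ⟩
    act ε x              ≡⟨ act-id x ⟩
    x                    ∎
    where open ≡.≡-Reasoning

  act-⁻¹ : ∀ g {x y} → act g x ≡ y → act (g ⁻¹) y ≡ x
  act-⁻¹ g {x} refl = act-inverseˡ g x

  act-injective : ∀ g {x y} → act g x ≡ act g y → x ≡ y
  act-injective g {x} eq = trans (sym (act-inverseˡ g x)) (act-⁻¹ g (sym eq))

  FixesBelow : ℕ → Carrier → Set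
  FixesBelow n g = ∀ (k : Fin m) → toℕ k < n → act g k ≡ k

  fixesBelow? : ∀ n → Decidable (FixesBelow n)
  fixesBelow? n g = Fin.all? (λ k → (toℕ k <? n) →-dec (act g k ≟ k))

  fixesBelow-resp : ∀ {n g h} → g ≈ h → FixesBelow n g → FixesBelow n h
  fixesBelow-resp g≈h fix k k<n = trans (sym (act-cong g≈h k)) (fix k k<n)

  fixesBelow-ε : ∀ n → FixesBelow n ε
  fixesBelow-ε n k _ = act-id k

  fixesBelow-⁻¹ : ∀ {n g} → FixesBelow n g → FixesBelow n (g ⁻¹)
  fixesBelow-⁻¹ fix k k<n = act-⁻¹ _ (fix k k<n)

  fixesBelow-∙ : ∀ {n g h} → FixesBelow n g → FixesBelow n h → FixesBelow n (g ∙ h)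
  fixesBelow-∙ {g = g} {h} fix-g fix-h k k<n =
    trans (act-∙ g h k) (trans (cong (act g) (fix-h k k<n)) (fix-g k k<n))

  fixesBelow-suc : ∀ {g} (i : Fin m) → FixesBelow (toℕ i) g → act g i ≡ i → FixesBelow (suc (toℕ i)) g
  fixesBelow-suc i fix gi≡i k k<1+i with m<1+n⇒m<n∨m≡n k<1+i
  ... | inj₁ k<i = fix k k<i
  ... | inj₂ k≡i rewrite toℕ-injective k≡i = gi≡i

  fixesBelow-pred : ∀ {n g} → FixesBelow (suc n) g → FixesBelow n g
  fixesBelow-pred fix k k<n = fix k (m<n⇒m<1+n k<n)

  stabilizer : ℕ → List Carrier
  stabilizer n = filter (fixesBelow? n) elems

  open Membership setoid using () renaming (_∈_ to _∈ᴳ_)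
  open import Data.List.Relation.Unary.Unique.Setoid setoid using () renaming (Unique to Uniqueᴳ)

  stabilizer-unique : ∀ n → Uniqueᴳ (stabilizer n)
  stabilizer-unique n = Unique.filter⁺ setoid (fixesBelow? n) distinct

  ∈-stabilizer⁺ : ∀ {n g} → FixesBelow n g → g ∈ᴳ stabilizer n
  ∈-stabilizer⁺ {n} {g} = Membershipₛ.∈-filter⁺ setoid (fixesBelow? n) fixesBelow-resp (complete g)

  ∈-stabilizer⁻ : ∀ {n g} → g ∈ᴳ stabilizer n → FixesBelow n g
  ∈-stabilizer⁻ {n} = proj₂ ∘ Membershipₛ.∈-filter⁻ setoid (fixesBelow? n) fixesBelow-resp {xs = elems}

  stabilizer-fixes : ∀ n → All (FixesBelow n) (stabilizer n)
  stabilizer-fixes n = All.all-filter (fixesBelow? n) elems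

  stabilizer-zero : stabilizer 0 ≡ elems
  stabilizer-zero = filter-all (fixesBelow? 0) (All.tabulate (λ _ _ ()))

  length-stabilizer-faithful : Faithful A → length (stabilizer m) ≡ 1
  length-stabilizer-faithful faithful = ≤-antisym
    (unique⇒length≤ setoid {ys = ε ∷ []} (stabilizer-unique m)
      (All.map (λ {g} fix → here (faithful g (λ x → fix x (toℕ<n x)))) (stabilizer-fixes m)))
    (unique⇒length≤ setoid ([] ∷ []) (∈-stabilizer⁺ (fixesBelow-ε m) ∷ []))

  switches-resp : ∀ {i j g h} → g ≈ h → Switches A i j g → Switches A i j h
  switches-resp g≈h (fix , gj≡i) = fixesBelow-resp g≈h fix , trans (sym (act-cong g≈h _)) gj≡i

  switches? : ∀ i j → Decidable (Switches A i j)
  switches? i j g = fixesBelow? (toℕ i) g ×-dec (act g j ≟ i)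

  switchable? : ∀ i j → Dec (∃ (Switches A i j))
  switchable? i j with Any.any? (switches? i j) elems
  ... | yes found = yes (Any.satisfied found)
  ... | no ¬found = no λ (g , sw) → ¬found (Any.map (λ g≈h → switches-resp g≈h sw) (complete g))

  switches⇒≤ : ∀ {i j g} → Switches A i j g → toℕ i ≤ toℕ j
  switches⇒≤ {j = j} (fix , gj≡i) =
    ≮⇒≥ λ j<i → <⇒≢ j<i (cong toℕ (trans (sym (fix j j<i)) gj≡i))

  Switchable : Set c
  Switchable = ∀ i j → toℕ i < toℕ j → ∃ (Switches A i j)

  switchable-≤ : Switchable → ∀ {i j} → toℕ i ≤ toℕ j → ∃ (Switches A i j)
  switchable-≤ sw {i} {j} i≤j with m≤n⇒m<n∨m≡n i≤j
  ... | inj₁ i<j = sw i j i<j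
  ... | inj₂ i≡j rewrite toℕ-injective i≡j = ε , fixesBelow-ε _ , act-id j

  -- Sifting π through the chain of stabilisers, one switch per point.
  undoBelow : Switchable → (π : Permutation′ m) → ∀ n → n ≤ m →
              ∃ λ h → ∀ k → toℕ k < n → act h (π ⟨$⟩ʳ k) ≡ k
  undoBelow sw π zero    _   = ε , λ _ ()
  undoBelow sw π (suc n) n<m with h , undo ← undoBelow sw π n (<⇒≤ n<m) = t ∙ h , undo′
    where
    i = fromℕ< n<m
    j = act h (π ⟨$⟩ʳ i)
    π-injective : ∀ {x y} → π ⟨$⟩ʳ x ≡ π ⟨$⟩ʳ y → x ≡ y
    π-injective eq =
      trans (sym (Permutation.inverseˡ π)) (trans (cong (π ⟨$⟩ˡ_) eq) (Permutation.inverseˡ π))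
    i≤j : toℕ i ≤ toℕ j
    i≤j = ≮⇒≥ λ j<i → <⇒≢ j<i (cong toℕ (π-injective (act-injective h
            (undo j (subst (toℕ j <_) (toℕ-fromℕ< n<m) j<i)))))
    t = proj₁ (switchable-≤ sw i≤j)
    t-switches : Switches A i j t
    t-switches = proj₂ (switchable-≤ sw i≤j)
    undo′ : ∀ k → toℕ k < suc n → act (t ∙ h) (π ⟨$⟩ʳ k) ≡ k
    undo′ k k<1+n with m<1+n⇒m<n∨m≡n k<1+n
    ... | inj₁ k<n = trans (act-∙ t h _) (trans (cong (act t) (undo k k<n))
                       (proj₁ t-switches k (subst (toℕ k <_) (sym (toℕ-fromℕ< n<m)) k<n)))
    ... | inj₂ k≡n rewrite toℕ-injective (trans k≡n (sym (toℕ-fromℕ< n<m))) =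
                       trans (act-∙ t h _) (proj₂ t-switches)

  switchable⇒fullSym : Switchable → InducesFullSym A
  switchable⇒fullSym sw π with h , undo ← undoBelow sw π m ≤-refl =
    h ⁻¹ , λ x → act-⁻¹ h (undo x (toℕ<n x))

  fullSym⇒switchable : InducesFullSym A → Switchable
  fullSym⇒switchable full i j i<j with g , g≗τ ← full (transpose j i) =
    g ,
    (λ k k<i → trans (g≗τ k) (transpose-other (≢-below (<-trans k<i i<j)) (≢-below k<i))) ,
    trans (g≗τ j) (transpose-matchˡ j i)
    where
    ≢-below : ∀ {k l : Fin m} → toℕ k < toℕ l → k ≢ l
    ≢-below k<l = <⇒≢ k<l ∘ cong toℕ

  module _ (T : SwitchTable A) where
    open SwitchTable T

    NontrivialEntry : Fin m → Fin m → Set ℓ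
    NontrivialEntry i j = toℕ i < toℕ j × ¬ (s i j ≈ ε)

    nontrivialEntry? : ∀ i → Decidable (NontrivialEntry i)
    nontrivialEntry? i j = (toℕ i <? toℕ j) ×-dec ¬? (s i j ≈? ε)

    orbit : Fin m → List (Fin m)
    orbit i = i ∷ filter (nontrivialEntry? i) (allFin m)

    σᵢ≡length-orbit : ∀ i → σᵢ i ≡ length (orbit i)
    σᵢ≡length-orbit i = cong (suc ∘ length) (filter-≐ _ (nontrivialEntry? i) (id , id) (allFin m))

    orbit-unique : ∀ i → Uniqueₚ (orbit i)
    orbit-unique i =
      All.map (λ (i<j , _) → <⇒≢ i<j ∘ cong toℕ) (All.all-filter (nontrivialEntry? i) (allFin m))
      ∷ Uniqueₚ.filter⁺ (nontrivialEntry? i) (Uniqueₚ.allFin⁺ m)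

    orbit-switches : ∀ {i j} → j ∈ orbit i → Switches A i j (s i j)
    orbit-switches {i} (here refl) = switches-resp (≈-sym (s-diag i)) (fixesBelow-ε _ , act-id i)
    orbit-switches {i} {j} (there j∈) with switchable? i j
    ... | yes switchable = s-switch i j switchable
    ... | no ¬switchable = ⊥-elim (sᵢⱼ≉ε (s-id i j ¬switchable))
      where sᵢⱼ≉ε = proj₂ (proj₂ (Membershipₚ.∈-filter⁻ (nontrivialEntry? i) {xs = allFin m} j∈))

    ∈-orbit : ∀ {i j} → ∃ (Switches A i j) → j ∈ orbit i
    ∈-orbit {i} {j} switchable with toℕ i ≟ℕ toℕ j
    ... | yes i≡j = here (toℕ-injective (sym i≡j))
    ... | no  i≢j =
      there (Membershipₚ.∈-filter⁺ (nontrivialEntry? i) (Membershipₚ.∈-allFin j) (i<j , sᵢⱼ≉ε))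
      where
      sw = s-switch i j switchable
      i<j = ≤∧≢⇒< (switches⇒≤ sw) i≢j
      sᵢⱼ≉ε : ¬ (s i j ≈ ε)
      sᵢⱼ≉ε sᵢⱼ≈ε = i≢j (cong toℕ (trans (sym (proj₂ sw)) (trans (act-cong sᵢⱼ≈ε j) (act-id j))))

    -- On G_(i), peel i is inverse to (j , h) ↦ s(i,j)⁻¹ h on orbit i × G_(i+1).
    peel : Fin m → Carrier → Fin m × Carrier
    peel i g = act g i , s i (act g i) ∙ g

    private
      Pairs = ≡.setoid (Fin m) ×ₛ setoid
      open Setoid Pairs using () renaming (_≈_ to _≈ₚ_)
      open Membership Pairs using () renaming (_∈_ to _∈ₚ_)

    peel-cong : ∀ i {g h} → g ≈ h → peel i g ≈ₚ peel i h
    peel-cong i {g} {h} g≈h with act g i | act-cong g≈h i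
    ... | _ | refl = refl , ∙-cong ≈-refl g≈h

    peel-injective : ∀ i {g h} → peel i g ≈ₚ peel i h → g ≈ h
    peel-injective i {g} (gi≡hi , eq) =
      ∙-cancelˡ (s i (act g i)) _ _ (≈-trans eq (∙-cong (≈-reflexive (cong (s i) (sym gi≡hi))) ≈-refl))

    peel-fixes : ∀ i {g} → FixesBelow (toℕ i) g → FixesBelow (suc (toℕ i)) (s i (act g i) ∙ g)
    peel-fixes i {g} fix = fixesBelow-suc i (fixesBelow-∙ (proj₁ sw) fix) (trans (act-∙ _ g i) (proj₂ sw))
      where sw = s-switch i (act g i) (g ⁻¹ , fixesBelow-⁻¹ fix , act-inverseˡ g i)

    unpeel-fixes : ∀ i {j h} → j ∈ orbit i → FixesBelow (suc (toℕ i)) h → FixesBelow (toℕ i) (s i j ⁻¹ ∙ h)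
    unpeel-fixes i j∈ fix = fixesBelow-∙ (fixesBelow-⁻¹ (proj₁ (orbit-switches j∈))) (fixesBelow-pred fix)

    peel-unpeel : ∀ i {j h} → j ∈ orbit i → FixesBelow (suc (toℕ i)) h → peel i (s i j ⁻¹ ∙ h) ≈ₚ (j , h)
    peel-unpeel i {j} {h} j∈ fix =
      lands , ≈-trans (∙-cong (≈-reflexive (cong (s i) lands)) ≈-refl) (\\-leftDividesˡ (s i j) h)
      where
      lands : act (s i j ⁻¹ ∙ h) i ≡ j
      lands = trans (act-∙ _ h i) (trans (cong (act (s i j ⁻¹)) (fix i (n<1+n (toℕ i))))
                (act-⁻¹ (s i j) (proj₂ (orbit-switches j∈))))

    stabilizer-step : ∀ i → length (stabilizer (toℕ i)) ≡ σᵢ i * length (stabilizer (suc (toℕ i)))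
    stabilizer-step i = begin
      length (stabilizer n)                          ≡⟨ length-≡-by-bijection setoid Pairs (peel-injective i)
                                                          (stabilizer-unique n) pairs-unique into onto ⟩
      length pairs                                   ≡⟨ length-cartesianProduct (orbit i) (stabilizer (suc n)) ⟩
      length (orbit i) * length (stabilizer (suc n)) ≡⟨ cong (_* length (stabilizer (suc n))) (σᵢ≡length-orbit i) ⟨
      σᵢ i * length (stabilizer (suc n))             ∎
      where
      open ≡.≡-Reasoning
      n = toℕ i
      pairs = cartesianProduct (orbit i) (stabilizer (suc n))
      pairs-unique = Unique.cartesianProduct⁺ (≡.setoid (Fin m)) setoid (orbit-unique i) (stabilizer-unique (suc n))
      into : All (λ g → peel i g ∈ₚ pairs) (stabilizer n)
      into = All.map (λ {g} fix → Membershipₛ.∈-cartesianProduct⁺ (≡.setoid (Fin m)) setoid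
                (∈-orbit (g ⁻¹ , fixesBelow-⁻¹ fix , act-inverseˡ g i)) (∈-stabilizer⁺ (peel-fixes i fix)))
             (stabilizer-fixes n)
      onto : All (_∈ₚ map (peel i) (stabilizer n)) pairs
      onto = All.tabulateₛ Pairs λ {(j , h)} jh∈ →
        let j∈ , h∈ = Membershipₛ.∈-cartesianProduct⁻ (≡.setoid (Fin m)) setoid (orbit i) _ jh∈
            fix = ∈-stabilizer⁻ h∈
        in Membershipₛ.∈-resp-≈ Pairs (peel-unpeel i j∈ fix)
             (Membershipₛ.∈-map⁺ setoid Pairs (peel-cong i) (∈-stabilizer⁺ (unpeel-fixes i j∈ fix)))

    σ≡product : σ ≡ product (tabulate σᵢ)
    σ≡product = cong product (map-tabulate id σᵢ)

    order≡σ*kernel : order ≡ σ * length (stabilizer m)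
    order≡σ*kernel = begin
      order                                         ≡⟨ cong length stabilizer-zero ⟨
      length (stabilizer 0)                         ≡⟨ telescope (length ∘ stabilizer) σᵢ stabilizer-step ⟩
      product (tabulate σᵢ) * length (stabilizer m) ≡⟨ cong (_* _) σ≡product ⟨
      σ * length (stabilizer m)                     ∎
      where open ≡.≡-Reasoning

    orbitIndices : Fin m → List ℕ
    orbitIndices i = map toℕ (orbit i)

    σᵢ≡length-orbitIndices : ∀ i → σᵢ i ≡ length (orbitIndices i)
    σᵢ≡length-orbitIndices i = trans (σᵢ≡length-orbit i) (sym (length-map toℕ (orbit i)))

    orbitIndices-unique : ∀ i → Uniqueₚ (orbitIndices i)
    orbitIndices-unique i = Uniqueₚ.map⁺ toℕ-injective (orbit-unique i)

    orbitIndices-⊆-interval : ∀ i → All (_∈ interval (toℕ i) m) (orbitIndices i)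
    orbitIndices-⊆-interval i =
      All.map⁺ (All.tabulate λ {j} j∈ → ∈-interval⁺ (switches⇒≤ (orbit-switches j∈)) (toℕ<n j))

    unswitchable⇒∉-orbitIndices : ∀ {i j} → ¬ ∃ (Switches A i j) → toℕ j ∉ orbitIndices i
    unswitchable⇒∉-orbitIndices {i} ¬switchable j∈ with j′ , j′∈ , j≡j′ ← Membershipₚ.∈-map⁻ toℕ j∈
      rewrite toℕ-injective j≡j′ = ¬switchable (s i j′ , orbit-switches j′∈)

    interval-⊆-orbitIndices : Switchable → ∀ i → All (_∈ orbitIndices i) (interval (toℕ i) m)
    interval-⊆-orbitIndices sw i = All.tabulate λ k∈ →
      let i≤k , k<m = ∈-interval⁻ (<⇒≤ (toℕ<n i)) k∈
          j = fromℕ< k<m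
          i≤j = subst (toℕ i ≤_) (sym (toℕ-fromℕ< k<m)) i≤k
      in subst (_∈ orbitIndices i) (toℕ-fromℕ< k<m) (Membershipₚ.∈-map⁺ toℕ (∈-orbit (switchable-≤ sw i≤j)))

    σᵢ≤m∸i : ∀ i → σᵢ i ≤ m ∸ toℕ i
    σᵢ≤m∸i i = begin
      σᵢ i                        ≡⟨ σᵢ≡length-orbitIndices i ⟩
      length (orbitIndices i)     ≤⟨ unique⇒length≤ (≡.setoid ℕ) (orbitIndices-unique i)
                                       (orbitIndices-⊆-interval i) ⟩
      length (interval (toℕ i) m) ≡⟨ length-interval (toℕ i) m ⟩
      m ∸ toℕ i                   ∎
      where open ≤-Reasoning

    -- An unswitchable j ≥ i is a further index in the interval [i, m).
    unswitchable⇒σᵢ<m∸i : ∀ {i j} → ¬ ∃ (Switches A i j) → toℕ i ≤ toℕ j → σᵢ i < m ∸ toℕ i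
    unswitchable⇒σᵢ<m∸i {i} {j} ¬switchable i≤j = begin-strict
      σᵢ i                        ≡⟨ σᵢ≡length-orbitIndices i ⟩
      length (orbitIndices i)     <⟨ unique⇒length≤ (≡.setoid ℕ) (j-new ∷ orbitIndices-unique i)
                                       (∈-interval⁺ i≤j (toℕ<n j) ∷ orbitIndices-⊆-interval i) ⟩
      length (interval (toℕ i) m) ≡⟨ length-interval (toℕ i) m ⟩
      m ∸ toℕ i                   ∎
      where
      open ≤-Reasoning
      j-new : All (toℕ j ≢_) (orbitIndices i)
      j-new = All.¬Any⇒All¬ (orbitIndices i) (unswitchable⇒∉-orbitIndices ¬switchable)

    switchable⇒σᵢ≡m∸i : Switchable → ∀ i → σᵢ i ≡ m ∸ toℕ i
    switchable⇒σᵢ≡m∸i sw i = ≤-antisym (σᵢ≤m∸i i) (begin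
      m ∸ toℕ i                   ≡⟨ length-interval (toℕ i) m ⟨
      length (interval (toℕ i) m) ≤⟨ unique⇒length≤ (≡.setoid ℕ) (interval-unique (toℕ i) m)
                                       (interval-⊆-orbitIndices sw i) ⟩
      length (orbitIndices i)     ≡⟨ σᵢ≡length-orbitIndices i ⟨
      σᵢ i                        ∎)
      where open ≤-Reasoning

    σᵢ≡m∸i⇒switchable : ∀ {i j} → σᵢ i ≡ m ∸ toℕ i → toℕ i < toℕ j → ∃ (Switches A i j)
    σᵢ≡m∸i⇒switchable {i} {j} σᵢ≡m∸i i<j with switchable? i j
    ... | yes switchable = switchable
    ... | no ¬switchable = ⊥-elim (<⇒≢ (unswitchable⇒σᵢ<m∸i ¬switchable (<⇒≤ i<j)) σᵢ≡m∸i)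

    m∸i≢0 : ∀ (i : Fin m) → NonZero (m ∸ toℕ i)
    m∸i≢0 i = >-nonZero (m<n⇒0<n∸m (toℕ<n i))

    σ≤m! : σ ≤ m !
    σ≤m! = begin
      σ                                              ≡⟨ σ≡product ⟩
      product (tabulate σᵢ)                          ≤⟨ product-tabulate-mono-≤ σᵢ≤m∸i ⟩
      product (tabulate (λ (i : Fin m) → m ∸ toℕ i)) ≡⟨ product-tabulate-∸ m ⟩
      m !                                            ∎
      where open ≤-Reasoning

    σ≡m!⇒switchable : σ ≡ m ! → Switchable
    σ≡m!⇒switchable σ≡m! i j = σᵢ≡m∸i⇒switchable (product-tabulate-≡⇒≗ σᵢ≤m∸i m∸i≢0 products≡ i)
      where
      products≡ : product (tabulate σᵢ) ≡ product (tabulate (λ (i : Fin m) → m ∸ toℕ i))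
      products≡ = trans (sym σ≡product) (trans σ≡m! (sym (product-tabulate-∸ m)))

    switchable⇒σ≡m! : Switchable → σ ≡ m !
    switchable⇒σ≡m! sw = begin
      σ                                              ≡⟨ σ≡product ⟩
      product (tabulate σᵢ)                          ≡⟨ cong product (tabulate-cong (switchable⇒σᵢ≡m∸i sw)) ⟩
      product (tabulate (λ (i : Fin m) → m ∸ toℕ i)) ≡⟨ product-tabulate-∸ m ⟩
      m !                                            ∎
      where open ≡.≡-Reasoning

    faithful⇒σ≡order : Faithful A → σ ≡ order
    faithful⇒σ≡order faithful = begin
      σ                         ≡⟨ *-identityʳ σ ⟨
      σ * 1                     ≡⟨ cong (σ *_) (length-stabilizer-faithful faithful) ⟨
      σ * length (stabilizer m) ≡⟨ order≡σ*kernel ⟨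
      order                     ∎
      where open ≡.≡-Reasoning

mainTheorem5 : ∀ {c ℓ} (G : FiniteGroup c ℓ) (m : ℕ) (A : Action G m)
    (T : SwitchTable A) →
    (SwitchTable.σ T ≤ m !)
    × ((SwitchTable.σ T ≡ m !) ⇔ InducesFullSym A)
    × (Faithful A → SwitchTable.σ T ≡ FiniteGroup.order G)
mainTheorem5 G m A T =
    σ≤m! A T
  , mk⇔ (switchable⇒fullSym A ∘ σ≡m!⇒switchable A T) (switchable⇒σ≡m! A T ∘ fullSym⇒switchable A)
  , faithful⇒σ≡order A T
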